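{- Let $m>3$ be square-free and let $p$ be an odd prime. Suppose $[u,v,p^bw]\in\mathcal{P}_m$ is the class of a primitive triple $(u,v,p^bw)$ with $\gcd(p,w)=1$ and $b\geq1$. Let $n\in\mathbb{N}$ and write $n\cdot[u,v,p^bw]=[u_n,v_n,w_n]$ with $\gcd(u_n,v_n)=1$. Then $p^{nb}\mid w_n$.
   Context: A triple $(a,b,c)\in\mathbb{Z}\times\mathbb{Z}\times\mathbb{N}$ with $a^2+mb^2=c^2$ is primitive if $\gcd(a,b,c)=1$. Two such triples $(a,b,c)$, $(A,B,C)$ are equivalent if there are nonzero integers $s,t$ with $s(a,b,c)=t(A,B,C)$, where $s(a,b,c)=(sa,sb,|sc|)$; the class of $(a,b,c)$ is $[a,b,c]$. The set $\mathcal{P}_m$ of classes is an abelian group under $[a,b,c]+[A,B,C]=[aA-mbB,\,aB+bA,\,cC]$, and $n\cdot x$ denotes the $n$-fold sum of $x$. -}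

module Defs where

open import Data.Nat as ℕ using (ℕ; zero; suc)
open import Data.Nat.Divisibility as ℕD using ()
open import Data.Nat.GCD using (gcd)
open import Data.Integer as ℤ using (ℤ; +_; ∣_∣)
open import Data.Product using (Σ; _×_; _,_; ∃)
open import Relation.Binary.PropositionalEquality using (_≡_; _≢_)

SquareFree : ℕ → Set
SquareFree m = ∀ d → (d ℕ.* d) ℕD.∣ m → d ≡ 1

Triple : Set
Triple = ℤ × ℤ × ℕ

IsTriple : ℕ → Triple → Set
IsTriple m (a , b , c) = a ℤ.* a ℤ.+ (+ m) ℤ.* (b ℤ.* b) ≡ + (c ℕ.* c)

Primitive : Triple → Set
Primitive (a , b , c) = gcd (gcd ∣ a ∣ ∣ b ∣) c ≡ 1

scale : ℤ → Triple → Triple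
scale s (a , b , c) = (s ℤ.* a , s ℤ.* b , ∣ s ∣ ℕ.* c)

Equiv : Triple → Triple → Set
Equiv x y = Σ ℤ λ s → Σ ℤ λ t → s ≢ ℤ.0ℤ × t ≢ ℤ.0ℤ × scale s x ≡ scale t y

add : ℕ → Triple → Triple → Triple
add m (a , b , c) (A , B , C) =
  (a ℤ.* A ℤ.- (+ m) ℤ.* (b ℤ.* B) , a ℤ.* B ℤ.+ b ℤ.* A , c ℕ.* C)

times : ℕ → ℕ → Triple → Triple
times m zero    x = (ℤ.1ℤ , ℤ.0ℤ , 1)
times m (suc n) x = add m x (times m n x)

{-# OPTIONS --safe #-}
-- Let (U n , V n , c ^ n) be the representative of n·[u,v,c] computed by the group law, so that
-- U n + V n √-m = (u + v √-m) ^ n.  Scaling it to the representative with coprime first entries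
-- divides all entries by the same k, so p ^ (n * b) ∣ c ^ n = k * wn and it suffices that p ∤ k,
-- i.e. that p does not divide both U n and V n.  Since p ∣ c, p divides the norm u² + m v², and
-- modulo such p one has v U n + u V n ≡ v (2u) ^ n; this is a unit, because p ∤ v by primitivity,
-- p ∤ u since m is square-free, and p is odd.
module Submission where

open import Defs
open import Data.Nat using (ℕ; _<_; _≤_; _*_; _^_)
open import Data.Nat.Divisibility using (_∣_)
open import Data.Nat.GCD using (gcd)
open import Data.Nat.Primality using (Prime)
open import Data.Integer using (ℤ; ∣_∣)
open import Data.Product using (_,_)
open import Relation.Nullary using (¬_)
open import Relation.Binary.PropositionalEquality using (_≡_)

open import Data.Nat using (zero; suc; ≢-nonZero; nonTrivial⇒≢1)
open import Data.Nat.Properties using (*-comm; *-assoc; *-cancelˡ-≡; ^-*-assoc)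
open import Data.Nat.Divisibility
  using (divides; quotient; ∣-refl; ∣-trans; ∣1⇒≡1; 1∣_; _∣0; m∣m*n; *-pres-∣; *-cancelˡ-∣)
open import Data.Nat.GCD using (gcd-greatest)
open import Data.Nat.Coprimality using (gcd≡1⇒coprime; coprime-factors)
open import Data.Nat.Primality using (prime[2]; prime⇒irreducible; prime⇒nonTrivial; prime⇒nonZero; euclidsLemma)
open import Data.Integer as ℤ using (+_)
open import Data.Integer.Properties using (abs-*; ∣i∣≡0⇒i≡0; neg-involutive)
open import Data.Integer.Divisibility.Signed
  using (∣ᵤ⇒∣; ∣⇒∣ᵤ; ∣m∣n⇒∣m-n; ∣m∣n⇒∣m+n; ∣m+n∣m⇒∣n; ∣m+n∣n⇒∣m; ∣m⇒∣-m; ∣n⇒∣m*n; ∣m⇒∣m*n)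
  renaming (_∣_ to _∣ᶻ_)
open import Data.Integer.Tactic.RingSolver using (solve-∀)
open import Data.Product using (Σ; _×_; proj₁; proj₂)
open import Data.Sum as Sum using (_⊎_; inj₁; inj₂; [_,_]′)
open import Data.Empty using (⊥-elim)
open import Function using (id; _∘_)
open import Relation.Binary.PropositionalEquality using (_≢_; refl; sym; trans; cong; subst; subst₂)
open Relation.Binary.PropositionalEquality.≡-Reasoning

prime∤1 : ∀ {p} → Prime p → ¬ p ∣ 1
prime∤1 pp p∣1 = nonTrivial⇒≢1 {{prime⇒nonTrivial pp}} (∣1⇒≡1 p∣1)

odd-prime∤2 : ∀ {p} → Prime p → ¬ 2 ∣ p → ¬ p ∣ 2
odd-prime∤2 pp 2∤p p∣2 with prime⇒irreducible prime[2] p∣2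
... | inj₁ refl = prime∤1 pp ∣-refl
... | inj₂ refl = 2∤p ∣-refl

squareFree∧p*p∣m*n⇒p∣n : ∀ {m n p} → SquareFree m → Prime p → p * p ∣ m * n → p ∣ n
squareFree∧p*p∣m*n⇒p∣n {m} {n} {p} sqf pp p²∣mn =
  [ p∣m⇒p∣n , id ]′ (euclidsLemma m n pp (∣-trans (m∣m*n p) p²∣mn))
  where
  instance _ = prime⇒nonZero pp
  p∣m⇒p∣n : p ∣ m → p ∣ n
  p∣m⇒p∣n (divides k m≡k*p) = [ ⊥-elim ∘ p∤k , id ]′ (euclidsLemma k n pp p∣k*n)
    where
    m*n≡p*[k*n] : m * n ≡ p * (k * n)
    m*n≡p*[k*n] = trans (cong (_* n) (trans m≡k*p (*-comm k p))) (*-assoc p k n)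
    p∣k*n : p ∣ k * n
    p∣k*n = *-cancelˡ-∣ p (subst (p * p ∣_) m*n≡p*[k*n] p²∣mn)
    p∤k : ¬ p ∣ k
    p∤k (divides j k≡j*p) = prime∤1 pp (subst (p ∣_) (sqf p (divides j m≡j*[p*p])) ∣-refl)
      where
      m≡j*[p*p] : m ≡ j * (p * p)
      m≡j*[p*p] = trans m≡k*p (trans (cong (_* p) k≡j*p) (*-assoc j p p))

prime^∣m*n⇒∣n : ∀ {p m} → Prime p → ¬ p ∣ m → ∀ e {n} → p ^ e ∣ m * n → p ^ e ∣ n
prime^∣m*n⇒∣n pp p∤m zero {n} _ = 1∣ n
prime^∣m*n⇒∣n {p} {m} pp p∤m (suc e) {n} p^e+1∣mn
  with euclidsLemma m n pp (∣-trans (m∣m*n (p ^ e)) p^e+1∣mn)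
... | inj₁ p∣m = ⊥-elim (p∤m p∣m)
... | inj₂ (divides n′ refl) =
  subst (p * p ^ e ∣_) (*-comm p n′) (*-pres-∣ (∣-refl {p}) p^e∣n′)
  where
  instance _ = prime⇒nonZero pp
  m*n′p≡p*mn′ : m * (n′ * p) ≡ p * (m * n′)
  m*n′p≡p*mn′ = begin
    m * (n′ * p) ≡⟨ cong (m *_) (*-comm n′ p) ⟩
    m * (p * n′) ≡⟨ sym (*-assoc m p n′) ⟩
    m * p * n′   ≡⟨ cong (_* n′) (*-comm m p) ⟩
    p * m * n′   ≡⟨ *-assoc p m n′ ⟩
    p * (m * n′) ∎
  p^e∣n′ : p ^ e ∣ n′
  p^e∣n′ = prime^∣m*n⇒∣n pp p∤m e (*-cancelˡ-∣ p (subst (p * p ^ e ∣_) m*n′p≡p*mn′ p^e+1∣mn))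

m∣m^n : ∀ m {n} → 1 ≤ n → m ∣ m ^ n
m∣m^n m {suc n} _ = m∣m*n (m ^ n)

^-pres-∣ : ∀ {m n} k → m ∣ n → m ^ k ∣ n ^ k
^-pres-∣ zero    m∣n = ∣-refl
^-pres-∣ (suc k) m∣n = *-pres-∣ m∣n (^-pres-∣ k m∣n)

module _ {p : ℕ} (pp : Prime p) where

  euclidsLemmaᶻ : ∀ i j → + p ∣ᶻ i ℤ.* j → + p ∣ᶻ i ⊎ + p ∣ᶻ j
  euclidsLemmaᶻ i j p∣ij =
    Sum.map ∣ᵤ⇒∣ ∣ᵤ⇒∣ (euclidsLemma ∣ i ∣ ∣ j ∣ pp (subst (p ∣_) (abs-* i j) (∣⇒∣ᵤ p∣ij)))

  prime∣ᶻi*i⇒∣i : ∀ {i} → + p ∣ᶻ i ℤ.* i → + p ∣ᶻ i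
  prime∣ᶻi*i⇒∣i {i} p∣i² = [ id , id ]′ (euclidsLemmaᶻ i i p∣i²)

  prime∤ᶻ^ : ∀ {i} → ¬ + p ∣ᶻ i → ∀ n → ¬ + p ∣ᶻ i ℤ.^ n
  prime∤ᶻ^ p∤i zero    p∣1 = prime∤1 pp (∣⇒∣ᵤ p∣1)
  prime∤ᶻ^ {i} p∤i (suc n) p∣iⁿ⁺¹ = [ p∤i , prime∤ᶻ^ p∤i n ]′ (euclidsLemmaᶻ i (i ℤ.^ n) p∣iⁿ⁺¹)

∣m∣m-n⇒∣n : ∀ {d x y} → d ∣ᶻ x → d ∣ᶻ x ℤ.- y → d ∣ᶻ y
∣m∣m-n⇒∣n {y = y} d∣x d∣x-y = subst (_ ∣ᶻ_) (neg-involutive y) (∣m⇒∣-m (∣m+n∣m⇒∣n d∣x-y d∣x))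

norm : ℕ → ℤ → ℤ → ℤ
norm m u v = u ℤ.* u ℤ.+ + m ℤ.* (v ℤ.* v)

module Multiples (m : ℕ) (u v : ℤ) (c : ℕ) where

  U V : ℕ → ℤ
  U n = proj₁ (times m n (u , v , c))
  V n = proj₁ (proj₂ (times m n (u , v , c)))

  C : ℕ → ℕ
  C n = proj₂ (proj₂ (times m n (u , v , c)))

  C≡c^n : ∀ n → C n ≡ c ^ n
  C≡c^n zero    = refl
  C≡c^n (suc n) = cong (c *_) (C≡c^n n)

  -- Modulo any divisor d of the norm, multiplication by u + v√-m acts on
  -- v U + u V as multiplication by 2u, because there u² - m v² ≡ 2u².
  ∣norm⇒∣vU+uV-v[2u]^n : ∀ {d} → d ∣ᶻ norm m u v →
                         ∀ n → d ∣ᶻ v ℤ.* U n ℤ.+ u ℤ.* V n ℤ.- v ℤ.* (+ 2 ℤ.* u) ℤ.^ n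
  ∣norm⇒∣vU+uV-v[2u]^n d∣norm zero =
    subst (_ ∣ᶻ_) (sym (base u v)) (∣ᵤ⇒∣ (_ ∣0))
    where
    base : ∀ u v → v ℤ.* ℤ.1ℤ ℤ.+ u ℤ.* ℤ.0ℤ ℤ.- v ℤ.* ℤ.1ℤ ≡ ℤ.0ℤ
    base = solve-∀
  ∣norm⇒∣vU+uV-v[2u]^n d∣norm (suc n) =
    subst (_ ∣ᶻ_) (sym (step u v (U n) (V n) (+ m) ((+ 2 ℤ.* u) ℤ.^ n)))
      (∣m∣n⇒∣m-n (∣n⇒∣m*n (+ 2 ℤ.* u) (∣norm⇒∣vU+uV-v[2u]^n d∣norm n)) (∣m⇒∣m*n (V n) d∣norm))
    where
    step : ∀ u v U V m w →
           v ℤ.* (u ℤ.* U ℤ.- m ℤ.* (v ℤ.* V)) ℤ.+ u ℤ.* (u ℤ.* V ℤ.+ v ℤ.* U) ℤ.- v ℤ.* (+ 2 ℤ.* u ℤ.* w)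
           ≡ + 2 ℤ.* u ℤ.* (v ℤ.* U ℤ.+ u ℤ.* V ℤ.- v ℤ.* w) ℤ.- (u ℤ.* u ℤ.+ m ℤ.* (v ℤ.* v)) ℤ.* V
    step = solve-∀

  prime∣U⇒∤V : ∀ {p} → Prime p → ¬ 2 ∣ p → + p ∣ᶻ norm m u v → ¬ + p ∣ᶻ u → ¬ + p ∣ᶻ v →
               ∀ n → + p ∣ᶻ U n → ¬ + p ∣ᶻ V n
  prime∣U⇒∤V pp 2∤p p∣norm p∤u p∤v n p∣U p∣V =
    [ p∤v , prime∤ᶻ^ pp p∤2u n ]′ (euclidsLemmaᶻ pp v _ p∣v[2u]^n)
    where
    p∤2u : ¬ + _ ∣ᶻ + 2 ℤ.* u
    p∤2u p∣2u = [ (λ p∣2 → odd-prime∤2 pp 2∤p (∣⇒∣ᵤ p∣2)) , p∤u ]′ (euclidsLemmaᶻ pp (+ 2) u p∣2u)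
    p∣v[2u]^n : + _ ∣ᶻ v ℤ.* (+ 2 ℤ.* u) ℤ.^ n
    p∣v[2u]^n = ∣m∣m-n⇒∣n (∣m∣n⇒∣m+n (∣n⇒∣m*n v p∣U) (∣n⇒∣m*n u p∣V)) (∣norm⇒∣vU+uV-v[2u]^n p∣norm n)

module PrimitiveTriple {m p : ℕ} {u v : ℤ} {c : ℕ} (pp : Prime p)
  (triple : IsTriple m (u , v , c)) (prim : Primitive (u , v , c)) (p∣c : p ∣ c) where

  p∣ᶻnorm : + p ∣ᶻ norm m u v
  p∣ᶻnorm = subst (+ p ∣ᶻ_) (sym triple) (∣ᵤ⇒∣ (∣-trans p∣c (m∣m*n c)))

  p∤ᶻv : ¬ + p ∣ᶻ v
  p∤ᶻv p∣v = prime∤1 pp (subst (p ∣_) prim (gcd-greatest (gcd-greatest (∣⇒∣ᵤ p∣u) (∣⇒∣ᵤ p∣v)) p∣c))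
    where
    p∣u : + p ∣ᶻ u
    p∣u = prime∣ᶻi*i⇒∣i pp (∣m+n∣n⇒∣m p∣ᶻnorm (∣n⇒∣m*n (+ m) (∣m⇒∣m*n v p∣v)))

  -- p ∣ u would make p² divide m v², hence (m being square-free) p ∣ v.
  p∤ᶻu : SquareFree m → ¬ + p ∣ᶻ u
  p∤ᶻu sqf p∣u = p∤ᶻv (prime∣ᶻi*i⇒∣i pp (∣ᵤ⇒∣ (squareFree∧p*p∣m*n⇒p∣n sqf pp p²∣m∣v²∣)))
    where
    p²∣ᶻu² : + (p * p) ∣ᶻ u ℤ.* u
    p²∣ᶻu² = ∣ᵤ⇒∣ (subst (p * p ∣_) (sym (abs-* u u)) (*-pres-∣ (∣⇒∣ᵤ p∣u) (∣⇒∣ᵤ p∣u)))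
    p²∣ᶻnorm : + (p * p) ∣ᶻ norm m u v
    p²∣ᶻnorm = subst (+ (p * p) ∣ᶻ_) (sym triple) (∣ᵤ⇒∣ (*-pres-∣ p∣c p∣c))
    p²∣m∣v²∣ : p * p ∣ m * ∣ v ℤ.* v ∣
    p²∣m∣v²∣ = subst (p * p ∣_) (abs-* (+ m) (v ℤ.* v)) (∣⇒∣ᵤ (∣m+n∣m⇒∣n p²∣ᶻnorm p²∣ᶻu²))

equiv-coprime⇒multiple : ∀ {a b c A B C} → Equiv (a , b , c) (A , B , C) → gcd ∣ a ∣ ∣ b ∣ ≡ 1 →
                         Σ ℕ λ k → ∣ A ∣ ≡ k * ∣ a ∣ × ∣ B ∣ ≡ k * ∣ b ∣ × C ≡ k * c
equiv-coprime⇒multiple {a} {b} {c} {A} {B} {C} (s , t , _ , t≢0 , eq) gcd≡1 =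
  k , cancel sa≡tA , cancel sb≡tB , cancel (cong (proj₂ ∘ proj₂) eq)
  where
  abs-eq : ∀ {x y} → s ℤ.* x ≡ t ℤ.* y → ∣ s ∣ * ∣ x ∣ ≡ ∣ t ∣ * ∣ y ∣
  abs-eq {x} {y} e = trans (sym (abs-* s x)) (trans (cong ∣_∣ e) (abs-* t y))
  sa≡tA : ∣ s ∣ * ∣ a ∣ ≡ ∣ t ∣ * ∣ A ∣
  sa≡tA = abs-eq (cong proj₁ eq)
  sb≡tB : ∣ s ∣ * ∣ b ∣ ≡ ∣ t ∣ * ∣ B ∣
  sb≡tB = abs-eq (cong (proj₁ ∘ proj₂) eq)
  t∣s*_ : ∀ {x y} → ∣ s ∣ * x ≡ ∣ t ∣ * y → ∣ t ∣ ∣ x * ∣ s ∣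
  t∣s*_ {x} {y} e = subst (∣ t ∣ ∣_) (trans (sym e) (*-comm ∣ s ∣ x)) (m∣m*n y)
  t∣s : ∣ t ∣ ∣ ∣ s ∣
  t∣s = coprime-factors (gcd≡1⇒coprime {m = ∣ a ∣} {n = ∣ b ∣} gcd≡1) (t∣s* sa≡tA , t∣s* sb≡tB)
  k : ℕ
  k = quotient t∣s
  instance _ = ≢-nonZero (λ ∣t∣≡0 → t≢0 (∣i∣≡0⇒i≡0 ∣t∣≡0))
  cancel : ∀ {x y} → ∣ s ∣ * x ≡ ∣ t ∣ * y → y ≡ k * x
  cancel {x} {y} e = *-cancelˡ-≡ y (k * x) ∣ t ∣ (begin
    ∣ t ∣ * y       ≡⟨ sym e ⟩
    ∣ s ∣ * x       ≡⟨ cong (_* x) (_∣_.equality t∣s) ⟩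
    k * ∣ t ∣ * x   ≡⟨ cong (_* x) (*-comm k ∣ t ∣) ⟩
    ∣ t ∣ * k * x   ≡⟨ *-assoc ∣ t ∣ k x ⟩
    ∣ t ∣ * (k * x) ∎)

lemma2 : (m : ℕ) → 3 < m → SquareFree m →
         (p : ℕ) → Prime p → ¬ (2 ∣ p) →
         (u v : ℤ) (b w : ℕ) → 1 ≤ b → gcd p w ≡ 1 →
         IsTriple m (u , v , p ^ b * w) → Primitive (u , v , p ^ b * w) →
         (n : ℕ) (un vn : ℤ) (wn : ℕ) →
         IsTriple m (un , vn , wn) → gcd ∣ un ∣ ∣ vn ∣ ≡ 1 →
         Equiv (un , vn , wn) (times m n (u , v , p ^ b * w)) →
         p ^ (n * b) ∣ wn
lemma2 m _ sqf p pp 2∤p u v b w b≥1 _ triple prim n un vn wn _ gcd≡1 equiv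
  with equiv-coprime⇒multiple equiv gcd≡1
... | k , ∣U∣≡k∣un∣ , ∣V∣≡k∣vn∣ , C≡k*wn =
  prime^∣m*n⇒∣n pp p∤k (n * b) (subst (p ^ (n * b) ∣_) C≡k*wn p^nb∣C)
  where
  open Multiples m u v (p ^ b * w)
  open PrimitiveTriple {m} {p} {u} {v} pp triple prim (∣-trans (m∣m^n p b≥1) (m∣m*n w))
  p^nb∣C : p ^ (n * b) ∣ C n
  p^nb∣C = subst₂ _∣_ (trans (^-*-assoc p b n) (cong (p ^_) (*-comm b n))) (sym (C≡c^n n))
                   (^-pres-∣ n (m∣m*n w))
  p∤k : ¬ p ∣ k
  p∤k p∣k = prime∣U⇒∤V pp 2∤p p∣ᶻnorm (p∤ᶻu sqf) p∤ᶻv n (p∣ᶻ ∣U∣≡k∣un∣) (p∣ᶻ ∣V∣≡k∣vn∣)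
    where
    p∣ᶻ : ∀ {X x} → ∣ X ∣ ≡ k * x → + p ∣ᶻ X
    p∣ᶻ e = ∣ᵤ⇒∣ (subst (p ∣_) (sym e) (∣-trans p∣k (m∣m*n _)))
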